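{- Let $G$ be a nontrivial uniquely $C_4^{+}$-saturated graph and let $u,v$ be any two non-adjacent vertices of $G$. Then the distance between $u$ and $v$ is $2$, and the number of paths of length $2$ between $u$ and $v$ is $1$ or $2$. Moreover, the number of such paths is $1$ if and only if there exists exactly one triangle $K_3$ in $G$ sharing a common edge with such a path.
   Context: All graphs are finite, simple and undirected. $C_4^{+}$ (the diamond) is the graph obtained from a $4$-cycle by adding one chord, i.e. $K_4$ minus an edge. For a graph $H$, a graph $G$ is uniquely $H$-saturated if $G$ contains no subgraph isomorphic to $H$, but for every pair of non-adjacent vertices $u,v$ of $G$, the graph $G+uv$ contains exactly one subgraph isomorphic to $H$. A uniquely $H$-saturated graph is nontrivial if it has at least $|V(H)|$ vertices. -}

module Defs where

open import Data.Nat using (ℕ; zero; suc; _+_; _<_; _≤_)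
open import Data.Bool using (Bool; true; false; _∧_; _∨_; not; if_then_else_)
open import Data.Fin using (Fin; _<?_; _≟_)
open import Data.List using (List; map; allFin)
open import Data.Nat.ListAction using (sum)
open import Data.Product using (_×_; Σ)
open import Relation.Nullary using (¬_; does)
open import Relation.Binary.PropositionalEquality using (_≡_)

record Graph (n : ℕ) : Set where
  field
    adj   : Fin n → Fin n → Bool
    sym   : ∀ x y → adj x y ≡ adj y x
    irrefl : ∀ x → adj x x ≡ false
open Graph public

Adj : ∀ {n} → Graph n → Fin n → Fin n → Set
Adj G x y = adj G x y ≡ true

ind : Bool → ℕ
ind b = if b then 1 else 0

Σ[_]_ : (n : ℕ) → (Fin n → ℕ) → ℕ
Σ[ n ] f = sum (map f (allFin n))

lt : ∀ {n} → Fin n → Fin n → Bool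
lt x y = does (x <? y)

neq : ∀ {n} → Fin n → Fin n → Bool
neq x y = not (does (x ≟ y))

-- Number of subgraphs isomorphic to the diamond C4+ (= K4 minus an edge)
-- in the graph with adjacency a.  A copy of the diamond is determined by
-- its chord {x,y} (the edge between the two degree-3 vertices) and the
-- pair {z,w} of degree-2 vertices; its edges are xy, xz, xw, yz, yw.
diamondCount : ∀ {n} → (Fin n → Fin n → Bool) → ℕ
diamondCount {n} a =
  Σ[ n ] λ x → Σ[ n ] λ y → Σ[ n ] λ z → Σ[ n ] λ w →
    ind (lt x y ∧ lt z w ∧ neq x z ∧ neq x w ∧ neq y z ∧ neq y w
         ∧ a x y ∧ a x z ∧ a x w ∧ a y z ∧ a y w)

addEdge : ∀ {n} → (Fin n → Fin n → Bool) → Fin n → Fin n → Fin n → Fin n → Bool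
addEdge a u v x y =
  a x y ∨ (does (x ≟ u) ∧ does (y ≟ v)) ∨ (does (x ≟ v) ∧ does (y ≟ u))

UniquelyDiamondSaturated : ∀ {n} → Graph n → Set
UniquelyDiamondSaturated {n} G =
  diamondCount (adj G) ≡ 0 ×
  (∀ u v → ¬ u ≡ v → ¬ Adj G u v → diamondCount (addEdge (adj G) u v) ≡ 1)

-- nontrivial: at least |V(C4+)| = 4 vertices
Nontrivial : ∀ {n} → Graph n → Set
Nontrivial {n} _ = 4 ≤ n

data Walk {n} (G : Graph n) : Fin n → Fin n → ℕ → Set where
  here : ∀ {x} → Walk G x x 0
  step : ∀ {x y z k} → Adj G x y → Walk G y z k → Walk G x z (suc k)

Distance : ∀ {n} → Graph n → Fin n → Fin n → ℕ → Set
Distance G x y d = Walk G x y d × (∀ k → k < d → ¬ Walk G x y k)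

-- number of paths of length 2 between u and v (u-w-v, w a common neighbour;
-- w ≠ u, v holds automatically by irreflexivity)
paths2 : ∀ {n} → Graph n → Fin n → Fin n → ℕ
paths2 {n} G u v = Σ[ n ] λ w → ind (adj G u w ∧ adj G w v)

onPath2 : ∀ {n} → Graph n → Fin n → Fin n → Fin n → Fin n → Bool
onPath2 {n} G u v p q =
  adj G p q ∧
  (((does (p ≟ u) ∨ does (p ≟ v)) ∧ adj G u q ∧ adj G q v) ∨
   ((does (q ≟ u) ∨ does (q ≟ v)) ∧ adj G u p ∧ adj G p v))

trianglesOnPaths2 : ∀ {n} → Graph n → Fin n → Fin n → ℕ
trianglesOnPaths2 {n} G u v =
  Σ[ n ] λ x → Σ[ n ] λ y → Σ[ n ] λ z →
    ind (lt x y ∧ lt y z ∧ adj G x y ∧ adj G y z ∧ adj G x z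
         ∧ (onPath2 G u v x y ∨ onPath2 G u v y z ∨ onPath2 G u v x z))

{-# OPTIONS --safe #-}

-- Since G has no diamond, the unique diamond of G + uv contains the edge uv.
-- If uv is its chord, its two tips are distinct common neighbours of u and v;
-- if uv is one of its sides, it consists of a path u–q–v together with a
-- triangle of G on the path edge uq or qv.  Conversely, two distinct common
-- neighbours, and a triangle on an edge of a path u–q–v, each give a diamond
-- of G + uv, and comparing such diamonds with the unique one shows: three
-- common neighbours c₁ c₂ c₃ are impossible (u v c₁ c₂ and u v c₁ c₃ differ),
-- a triangle on a path forces the common neighbour to be unique, and such a
-- triangle is itself unique.  With exactly one common neighbour the unique
-- diamond cannot have uv as its chord, so such a triangle exists.

module Submission where

open import Defs renaming (sym to adj-sym)
open import Data.Bool using (Bool; true; false; _∧_; _∨_; not)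
open import Data.Bool.Properties using (∧-comm; ∨-comm; ∨-zeroʳ)
open import Data.Empty using (⊥-elim)
open import Data.Fin using (Fin; zero; suc; _<?_; _≟_) renaming (_<_ to _<ᶠ_)
open import Data.Fin.Properties using (0≢1+n; suc-injective; <-cmp; <⇒≢; ≤-totalOrder)
open import Data.List using (List; []; _∷_)
open import Data.List.Properties using (map-tabulate)
open import Data.List.Relation.Binary.Permutation.Propositional
  using (_↭_; ↭⇒↭ₛ; ↭-refl; ↭-sym; ↭-trans; ↭-prep; ↭-swap)
open import Data.List.Relation.Binary.Pointwise using ([]; _∷_)
open import Data.List.Relation.Unary.All using (All; []; _∷_)
open import Data.List.Relation.Unary.Linked using ([-]; _∷_)
open import Data.List.Relation.Unary.Sorted.TotalOrder.Properties using (↗↭↗⇒≋)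
open import Data.Nat using (ℕ; zero; suc; _+_; _≤_; _<_; z≤n; s≤s)
open import Data.Nat.ListAction using (sum)
open import Data.Nat.Properties
  using (≤-trans; ≤-reflexive; ≤-antisym; m≤m+n; m≤n+m; +-mono-≤; ≮⇒≥; n≤0⇒n≡0; <⇒≤)
open import Data.Product using (_×_; _,_; proj₁; proj₂; ∃-syntax)
open import Data.Sum using (_⊎_; inj₁; inj₂)
import Data.Sum as Sum
open import Function.Base using (id; _∘_)
open import Function.Bundles using (_⇔_; mk⇔)
open import Relation.Binary.Definitions using (tri<; tri≈; tri>)
open import Relation.Binary.PropositionalEquality
  using (_≡_; _≢_; refl; sym; trans; cong; cong₂; subst; module ≡-Reasoning)
open import Relation.Nullary using (¬_; Dec; yes; no; does)
open import Relation.Nullary.Decidable using (dec-true; dec-false)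

private
  variable
    n : ℕ

-- `⋀ (b₁ ∷ … ∷ bₖ ∷ [])` unfolds to `b₁ ∧ … ∧ bₖ` without a trailing `∧ true`,
-- so it matches the conjunctions in the indicators of Defs definitionally.
⋀ : List Bool → Bool
⋀ []           = true
⋀ (b ∷ [])     = b
⋀ (b ∷ c ∷ bs) = b ∧ ⋀ (c ∷ bs)

⋀⁻ : ∀ bs → ⋀ bs ≡ true → All (_≡ true) bs
⋀⁻ []               _  = []
⋀⁻ (b ∷ [])         e  = e ∷ []
⋀⁻ (true ∷ c ∷ bs)  e  = refl ∷ ⋀⁻ (c ∷ bs) e

⋀⁺ : ∀ {bs} → All (_≡ true) bs → ⋀ bs ≡ true
⋀⁺ []                  = refl
⋀⁺ (e ∷ [])            = e
⋀⁺ (refl ∷ es@(_ ∷ _)) = ⋀⁺ es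

∨-true⁻ : ∀ a {b} → a ∨ b ≡ true → a ≡ true ⊎ b ≡ true
∨-true⁻ true  _ = inj₁ refl
∨-true⁻ false e = inj₂ e

∨-trueˡ : ∀ {a} b → a ≡ true → a ∨ b ≡ true
∨-trueˡ b refl = refl

∨-trueʳ : ∀ a {b} → b ≡ true → a ∨ b ≡ true
∨-trueʳ a refl = ∨-zeroʳ a

0<ind⇒true : ∀ {b} → 0 < ind b → b ≡ true
0<ind⇒true {true} _ = refl

true⇒0<ind : ∀ {b} → b ≡ true → 0 < ind b
true⇒0<ind refl = s≤s z≤n

ind≤1 : ∀ b → ind b ≤ 1
ind≤1 true  = s≤s z≤n
ind≤1 false = z≤n

does-true⇒ : ∀ {A : Set} (a? : Dec A) → does a? ≡ true → A
does-true⇒ (yes a) _ = a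

neq-true : ∀ {x y : Fin n} → x ≢ y → neq x y ≡ true
neq-true {x = x} {y} x≢y = cong not (dec-false (x ≟ y) x≢y)

1≤m≤2⇒m≡1⊎m≡2 : ∀ {m} → 1 ≤ m → m ≤ 2 → m ≡ 1 ⊎ m ≡ 2
1≤m≤2⇒m≡1⊎m≡2 (s≤s _) (s≤s z≤n)       = inj₁ refl
1≤m≤2⇒m≡1⊎m≡2 (s≤s _) (s≤s (s≤s z≤n)) = inj₂ refl

Σ-suc : (f : Fin (suc n) → ℕ) → Σ[ suc n ] f ≡ f zero + Σ[ n ] (f ∘ suc)
Σ-suc f = cong (λ xs → f zero + sum xs)
  (trans (map-tabulate suc f) (sym (map-tabulate id (f ∘ suc))))

≤-Σ : (f : Fin n → ℕ) (i : Fin n) → f i ≤ Σ[ n ] f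
≤-Σ {suc n} f zero    rewrite Σ-suc f = m≤m+n (f zero) _
≤-Σ {suc n} f (suc i) rewrite Σ-suc f = ≤-trans (≤-Σ (f ∘ suc) i) (m≤n+m _ (f zero))

Σ-pos⇒∃ : (f : Fin n → ℕ) → 0 < Σ[ n ] f → ∃[ i ] 0 < f i
Σ-pos⇒∃ {suc n} f 0<Σ rewrite Σ-suc f with f zero in eq
... | suc _ = zero , subst (0 <_) (sym eq) (s≤s z≤n)
... | zero with i , 0<fi ← Σ-pos⇒∃ (f ∘ suc) 0<Σ = suc i , 0<fi

Σ≤1⇒unique : (f : Fin n → ℕ) → Σ[ n ] f ≤ 1 → ∀ {i j} → 0 < f i → 0 < f j → i ≡ j
Σ≤1⇒unique {suc n} f Σ≤1 {zero}  {zero}  _    _    = refl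
Σ≤1⇒unique {suc n} f Σ≤1 {zero}  {suc j} 0<f₀ 0<fⱼ with s≤s () ←
  ≤-trans (+-mono-≤ 0<f₀ (≤-trans 0<fⱼ (≤-Σ (f ∘ suc) j))) (subst (_≤ 1) (Σ-suc f) Σ≤1)
Σ≤1⇒unique {suc n} f Σ≤1 {suc i} {zero}  0<fᵢ 0<f₀ = sym (Σ≤1⇒unique f Σ≤1 0<f₀ 0<fᵢ)
Σ≤1⇒unique {suc n} f Σ≤1 {suc i} {suc j} 0<fᵢ 0<fⱼ = cong suc
  (Σ≤1⇒unique (f ∘ suc) (≤-trans (m≤n+m _ (f zero)) (subst (_≤ 1) (Σ-suc f) Σ≤1)) 0<fᵢ 0<fⱼ)

Σ≤1 : (f : Fin n → ℕ) → (∀ i → f i ≤ 1) → (∀ {i j} → 0 < f i → 0 < f j → i ≡ j) →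
      Σ[ n ] f ≤ 1
Σ≤1 {zero}  f _   _      = z≤n
Σ≤1 {suc n} f f≤1 unique rewrite Σ-suc f with f zero in eq | f≤1 zero
... | zero        | _ = Σ≤1 (f ∘ suc) (f≤1 ∘ suc) (λ p q → suc-injective (unique p q))
... | suc (suc _) | s≤s ()
... | suc zero    | _ = ≤-reflexive (cong suc rest≡0)
  where
  rest≡0 : Σ[ n ] (f ∘ suc) ≡ 0
  rest≡0 = n≤0⇒n≡0 (≮⇒≥ λ 0<Σ → let i , 0<fᵢ = Σ-pos⇒∃ (f ∘ suc) 0<Σ in
    0≢1+n (unique (subst (0 <_) (sym eq) (s≤s z≤n)) 0<fᵢ))

Σ≤2 : (f : Fin n → ℕ) → (∀ i → f i ≤ 1) →
      (∀ {i j k} → 0 < f i → 0 < f j → 0 < f k → i ≡ j ⊎ i ≡ k ⊎ j ≡ k) →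
      Σ[ n ] f ≤ 2
Σ≤2 {zero}  f _   _        = z≤n
Σ≤2 {suc n} f f≤1 coincide rewrite Σ-suc f with f zero in eq | f≤1 zero
... | zero        | _ = Σ≤2 (f ∘ suc) (f≤1 ∘ suc) λ p q r →
  Sum.map suc-injective (Sum.map suc-injective suc-injective) (coincide p q r)
... | suc (suc _) | s≤s ()
... | suc zero    | _ = s≤s (Σ≤1 (f ∘ suc) (f≤1 ∘ suc) unique)
  where
  unique : ∀ {i j} → 0 < f (suc i) → 0 < f (suc j) → i ≡ j
  unique p q with coincide (subst (0 <_) (sym eq) (s≤s z≤n)) p q
  ... | inj₁ 0≡1+i        = ⊥-elim (0≢1+n 0≡1+i)
  ... | inj₂ (inj₁ 0≡1+j) = ⊥-elim (0≢1+n 0≡1+j)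
  ... | inj₂ (inj₂ i≡j)   = suc-injective i≡j

Σ² : (Fin n → Fin n → ℕ) → ℕ
Σ² {n} F = Σ[ n ] λ x → Σ[ n ] λ y → F x y

≤-Σ² : (F : Fin n → Fin n → ℕ) (x y : Fin n) → F x y ≤ Σ² F
≤-Σ² {n} F x y = ≤-trans (≤-Σ (F x) y) (≤-Σ (λ x → Σ[ n ] (F x)) x)

Σ²-pos⇒∃ : (F : Fin n → Fin n → ℕ) → 0 < Σ² F → ∃[ x ] ∃[ y ] 0 < F x y
Σ²-pos⇒∃ F 0<Σ with x , 0<Σₓ ← Σ-pos⇒∃ _ 0<Σ with y , 0<Fxy ← Σ-pos⇒∃ (F x) 0<Σₓ =
  x , y , 0<Fxy

Σ²≤1⇒unique : (F : Fin n → Fin n → ℕ) → Σ² F ≤ 1 →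
              ∀ {x y x′ y′} → 0 < F x y → 0 < F x′ y′ → x ≡ x′ × y ≡ y′
Σ²≤1⇒unique {n} F Σ≤1 {x} {y} {x′} {y′} p q
  with refl ← Σ≤1⇒unique (λ x → Σ[ n ] (F x)) Σ≤1
                (≤-trans p (≤-Σ (F x) y)) (≤-trans q (≤-Σ (F x′) y′))
  = refl , Σ≤1⇒unique (F x) (≤-trans (≤-Σ (λ x → Σ[ n ] (F x)) x) Σ≤1) p q

Σ²≤1 : (F : Fin n → Fin n → ℕ) → (∀ x y → F x y ≤ 1) →
       (∀ {x y x′ y′} → 0 < F x y → 0 < F x′ y′ → x ≡ x′ × y ≡ y′) → Σ² F ≤ 1
Σ²≤1 {n} F F≤1 unique =
  Σ≤1 (λ x → Σ[ n ] (F x)) (λ x → Σ≤1 (F x) (F≤1 x) (λ p q → proj₂ (unique p q)))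
    λ {x} {x′} p q →
      let _ , p′ = Σ-pos⇒∃ (F x) p
          _ , q′ = Σ-pos⇒∃ (F x′) q
      in proj₁ (unique p′ q′)

Σ³ : (Fin n → Fin n → Fin n → ℕ) → ℕ
Σ³ {n} F = Σ² λ x y → Σ[ n ] (F x y)

≤-Σ³ : (F : Fin n → Fin n → Fin n → ℕ) (x y z : Fin n) → F x y z ≤ Σ³ F
≤-Σ³ {n} F x y z = ≤-trans (≤-Σ (F x y) z) (≤-Σ² (λ x y → Σ[ n ] (F x y)) x y)

Σ³-pos⇒∃ : (F : Fin n → Fin n → Fin n → ℕ) → 0 < Σ³ F → ∃[ x ] ∃[ y ] ∃[ z ] 0 < F x y z
Σ³-pos⇒∃ F 0<Σ with x , y , 0<Σₓᵧ ← Σ²-pos⇒∃ _ 0<Σ with z , 0<F ← Σ-pos⇒∃ (F x y) 0<Σₓᵧ =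
  x , y , z , 0<F

Σ³≤1 : (F : Fin n → Fin n → Fin n → ℕ) → (∀ x y z → F x y z ≤ 1) →
       (∀ {x y z x′ y′ z′} → 0 < F x y z → 0 < F x′ y′ z′ → x ≡ x′ × y ≡ y′ × z ≡ z′) →
       Σ³ F ≤ 1
Σ³≤1 {n} F F≤1 unique =
  Σ²≤1 (λ x y → Σ[ n ] (F x y))
    (λ x y → Σ≤1 (F x y) (F≤1 x y) (λ p q → proj₂ (proj₂ (unique p q))))
    λ {x} {y} {x′} {y′} p q →
      let _ , p′ = Σ-pos⇒∃ (F x y) p
          _ , q′ = Σ-pos⇒∃ (F x′ y′) q
          x≡x′ , y≡y′ , _ = unique p′ q′
      in x≡x′ , y≡y′

data SamePair {n} : Fin n → Fin n → Fin n → Fin n → Set where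
  same    : ∀ {x y} → SamePair x y x y
  swapped : ∀ {x y} → SamePair x y y x

SamePair-sym : ∀ {x y x′ y′ : Fin n} → SamePair x y x′ y′ → SamePair x′ y′ x y
SamePair-sym same    = same
SamePair-sym swapped = swapped

SamePair-trans : ∀ {x y x′ y′ x″ y″ : Fin n} →
                 SamePair x y x′ y′ → SamePair x′ y′ x″ y″ → SamePair x y x″ y″
SamePair-trans same    q       = q
SamePair-trans swapped same    = swapped
SamePair-trans swapped swapped = same

sort-pair : ∀ {x y : Fin n} → x ≢ y → ∃[ x′ ] ∃[ y′ ] x′ <ᶠ y′ × SamePair x y x′ y′
sort-pair {x = x} {y} x≢y with <-cmp x y
... | tri< x<y _ _ = x , y , x<y , same
... | tri≈ _ x≡y _ = ⊥-elim (x≢y x≡y)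
... | tri> _ _ y<x = y , x , y<x , swapped

module _ (P : Fin n → Fin n → Fin n → Set)
         (distinct : ∀ {x y z} → P x y z → x ≢ y)
         (swap₁₂ : ∀ {x y z} → P x y z → P y x z)
         (swap₂₃ : ∀ {x y z} → P x y z → P x z y) where

  Sorted₃ : Set
  Sorted₃ = ∃[ x ] ∃[ y ] ∃[ z ] x <ᶠ y × y <ᶠ z × P x y z

  sort₃-insert : ∀ {a b c} → a <ᶠ b → P a b c → Sorted₃
  sort₃-insert {a} {b} {c} a<b p with <-cmp b c
  ... | tri< b<c _ _ = a , b , c , a<b , b<c , p
  ... | tri≈ _ b≡c _ = ⊥-elim (distinct (swap₂₃ (swap₁₂ p)) b≡c)
  ... | tri> _ _ c<b with <-cmp a c
  ...   | tri< a<c _ _ = a , c , b , a<c , c<b , swap₂₃ p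
  ...   | tri≈ _ a≡c _ = ⊥-elim (distinct (swap₂₃ p) a≡c)
  ...   | tri> _ _ c<a = c , a , b , c<a , a<b , swap₁₂ (swap₂₃ p)

  sort₃ : ∀ {x y z} → P x y z → Sorted₃
  sort₃ {x} {y} p with <-cmp x y
  ... | tri< x<y _ _ = sort₃-insert x<y p
  ... | tri≈ _ x≡y _ = ⊥-elim (distinct p x≡y)
  ... | tri> _ _ y<x = sort₃-insert y<x (swap₁₂ p)

sorted₃-↭-unique : ∀ {x y z x′ y′ z′ : Fin n} →
  x <ᶠ y → y <ᶠ z → x′ <ᶠ y′ → y′ <ᶠ z′ →
  (x ∷ y ∷ z ∷ []) ↭ (x′ ∷ y′ ∷ z′ ∷ []) → x ≡ x′ × y ≡ y′ × z ≡ z′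
sorted₃-↭-unique {n} x<y y<z x′<y′ y′<z′ π
  with x≡x′ ∷ y≡y′ ∷ z≡z′ ∷ [] ← ↗↭↗⇒≋ (≤-totalOrder n)
         (<⇒≤ x<y ∷ <⇒≤ y<z ∷ [-]) (<⇒≤ x′<y′ ∷ <⇒≤ y′<z′ ∷ [-]) (↭⇒↭ₛ π)
  = x≡x′ , y≡y′ , z≡z′

diamondConjuncts : (Fin n → Fin n → Bool) → Fin n → Fin n → Fin n → Fin n → List Bool
diamondConjuncts a x y z w =
  lt x y ∷ lt z w ∷ neq x z ∷ neq x w ∷ neq y z ∷ neq y w ∷
  a x y ∷ a x z ∷ a x w ∷ a y z ∷ a y w ∷ []

-- `diamondCount a` is definitionally `Σ² λ x y → Σ² (diamondIndicator a x y)`.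
diamondIndicator : (Fin n → Fin n → Bool) → Fin n → Fin n → Fin n → Fin n → ℕ
diamondIndicator a x y z w = ind (⋀ (diamondConjuncts a x y z w))

≤-diamondCount : (a : Fin n → Fin n → Bool) (x y z w : Fin n) →
                 diamondIndicator a x y z w ≤ diamondCount a
≤-diamondCount a x y z w = ≤-trans (≤-Σ² (diamondIndicator a x y) z w)
                                   (≤-Σ² (λ x y → Σ² (diamondIndicator a x y)) x y)

record Diamond (G : Graph n) (x y z w : Fin n) : Set where
  field
    z≢w : z ≢ w
    x~y : Adj G x y
    x~z : Adj G x z
    x~w : Adj G x w
    y~z : Adj G y z
    y~w : Adj G y w
open Diamond

module _ (G : Graph n) where

  Adj-sym : ∀ {x y} → Adj G x y → Adj G y x
  Adj-sym {x} {y} x~y = trans (adj-sym G y x) x~y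

  Adj⇒≢ : ∀ {x y} → Adj G x y → x ≢ y
  Adj⇒≢ {x} x~x refl with () ← trans (sym (irrefl G x)) x~x

  common-neighbour⇒distance₂ : ∀ {u v c} → u ≢ v → ¬ Adj G u v →
                               Adj G u c → Adj G c v → Distance G u v 2
  common-neighbour⇒distance₂ u≢v u≁v u~c c~v = step u~c (step c~v here) , shorter
    where
    shorter : ∀ k → k < 2 → ¬ Walk G _ _ k
    shorter zero          _                here            = u≢v refl
    shorter (suc zero)    _                (step u~v here) = u≁v u~v
    shorter (suc (suc k)) (s≤s (s≤s ()))

  Diamond-swap-chord : ∀ {x y z w} → Diamond G x y z w → Diamond G y x z w
  Diamond-swap-chord d = record
    { z≢w = z≢w d ; x~y = Adj-sym (x~y d)
    ; x~z = y~z d ; x~w = y~w d ; y~z = x~z d ; y~w = x~w d }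

  Diamond-swap-tips : ∀ {x y z w} → Diamond G x y z w → Diamond G x y w z
  Diamond-swap-tips d = record
    { z≢w = z≢w d ∘ sym ; x~y = x~y d
    ; x~z = x~w d ; x~w = x~z d ; y~z = y~w d ; y~w = y~z d }

  Diamond-cong : ∀ {x y z w x′ y′ z′ w′} → SamePair x y x′ y′ → SamePair z w z′ w′ →
                 Diamond G x y z w → Diamond G x′ y′ z′ w′
  Diamond-cong same    same    = id
  Diamond-cong swapped same    = Diamond-swap-chord
  Diamond-cong same    swapped = Diamond-swap-tips
  Diamond-cong swapped swapped = Diamond-swap-chord ∘ Diamond-swap-tips

  sorted-Diamond⇒indicator : ∀ {x y z w} → x <ᶠ y → z <ᶠ w → Diamond G x y z w →
                             0 < diamondIndicator (adj G) x y z w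
  sorted-Diamond⇒indicator {x} {y} {z} {w} x<y z<w d = true⇒0<ind (⋀⁺
    (dec-true (x <? y) x<y ∷ dec-true (z <? w) z<w ∷
     neq-true (Adj⇒≢ (x~z d)) ∷ neq-true (Adj⇒≢ (x~w d)) ∷
     neq-true (Adj⇒≢ (y~z d)) ∷ neq-true (Adj⇒≢ (y~w d)) ∷
     x~y d ∷ x~z d ∷ x~w d ∷ y~z d ∷ y~w d ∷ []))

  indicator⇒Diamond : ∀ {x y z w} → 0 < diamondIndicator (adj G) x y z w → Diamond G x y z w
  indicator⇒Diamond {x} {y} {z} {w} h
    with _ ∷ z<w ∷ _ ∷ _ ∷ _ ∷ _ ∷ x~y ∷ x~z ∷ x~w ∷ y~z ∷ y~w ∷ [] ←
         ⋀⁻ (diamondConjuncts (adj G) x y z w) (0<ind⇒true h)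
    = record { z≢w = <⇒≢ (does-true⇒ (z <? w) z<w)
             ; x~y = x~y ; x~z = x~z ; x~w = x~w ; y~z = y~z ; y~w = y~w }

  sort-Diamond : ∀ {x y z w} → Diamond G x y z w →
    ∃[ x′ ] ∃[ y′ ] ∃[ z′ ] ∃[ w′ ]
      SamePair x y x′ y′ × SamePair z w z′ w′ × 0 < diamondIndicator (adj G) x′ y′ z′ w′
  sort-Diamond d
    with x′ , y′ , x′<y′ , chord ← sort-pair (Adj⇒≢ (x~y d))
       | z′ , w′ , z′<w′ , tips  ← sort-pair (z≢w d)
    = x′ , y′ , z′ , w′ , chord , tips ,
      sorted-Diamond⇒indicator x′<y′ z′<w′ (Diamond-cong chord tips d)

  Diamond⇒0<diamondCount : ∀ {x y z w} → Diamond G x y z w → 0 < diamondCount (adj G)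
  Diamond⇒0<diamondCount d with x , y , z , w , _ , _ , 0<I ← sort-Diamond d =
    ≤-trans 0<I (≤-diamondCount (adj G) x y z w)

  0<diamondCount⇒Diamond : 0 < diamondCount (adj G) → ∃[ x ] ∃[ y ] ∃[ z ] ∃[ w ] Diamond G x y z w
  0<diamondCount⇒Diamond 0<count
    with x , y , 0<Σ ← Σ²-pos⇒∃ _ 0<count
    with z , w , 0<I ← Σ²-pos⇒∃ (diamondIndicator (adj G) x y) 0<Σ
    = x , y , z , w , indicator⇒Diamond 0<I

  diamondCount≤1⇒Diamond-unique : diamondCount (adj G) ≤ 1 →
    ∀ {x y z w x′ y′ z′ w′} → Diamond G x y z w → Diamond G x′ y′ z′ w′ →
    SamePair x y x′ y′ × SamePair z w z′ w′
  diamondCount≤1⇒Diamond-unique count≤1 d d′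
    with x , y , z , w , chord , tips , 0<I ← sort-Diamond d
       | x′ , y′ , z′ , w′ , chord′ , tips′ , 0<I′ ← sort-Diamond d′
    with refl , refl ← Σ²≤1⇒unique (λ x y → Σ² (diamondIndicator (adj G) x y)) count≤1
                         {x} {y} {x′} {y′}
                         (≤-trans 0<I (≤-Σ² _ z w)) (≤-trans 0<I′ (≤-Σ² _ z′ w′))
    with refl , refl ← Σ²≤1⇒unique (diamondIndicator (adj G) x y)
                         (≤-trans (≤-Σ² (λ x y → Σ² (diamondIndicator (adj G) x y)) x y) count≤1)
                         {z} {w} {z′} {w′} 0<I 0<I′
    = SamePair-trans chord (SamePair-sym chord′) , SamePair-trans tips (SamePair-sym tips′)

module _ (G : Graph n) {u v : Fin n} (u≢v : u ≢ v) where

  withEdge : Graph n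
  withEdge = record
    { adj    = addEdge (adj G) u v
    ; sym    = sym′
    ; irrefl = irrefl′
    }
    where
    sym′ : ∀ x y → addEdge (adj G) u v x y ≡ addEdge (adj G) u v y x
    sym′ x y = cong₂ _∨_ (adj-sym G x y) (begin
      (does (x ≟ u) ∧ does (y ≟ v)) ∨ (does (x ≟ v) ∧ does (y ≟ u))
        ≡⟨ cong₂ _∨_ (∧-comm (does (x ≟ u)) _) (∧-comm (does (x ≟ v)) _) ⟩
      (does (y ≟ v) ∧ does (x ≟ u)) ∨ (does (y ≟ u) ∧ does (x ≟ v))
        ≡⟨ ∨-comm (does (y ≟ v) ∧ _) _ ⟩
      (does (y ≟ u) ∧ does (x ≟ v)) ∨ (does (y ≟ v) ∧ does (x ≟ u)) ∎)
      where open ≡-Reasoning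

    irrefl′ : ∀ x → addEdge (adj G) u v x x ≡ false
    irrefl′ x rewrite irrefl G x with x ≟ u | x ≟ v
    ... | yes x≡u | yes x≡v = ⊥-elim (u≢v (trans (sym x≡u) x≡v))
    ... | yes _   | no _    = refl
    ... | no _    | yes _   = refl
    ... | no _    | no _    = refl

  withEdge⁺ : ∀ {p q} → Adj G p q → Adj withEdge p q
  withEdge⁺ p~q = ∨-trueˡ _ p~q

  withEdge-new : ∀ {p q} → SamePair p q u v → Adj withEdge p q
  withEdge-new same    = ∨-trueʳ (adj G u v)
    (∨-trueˡ _ (⋀⁺ (dec-true (u ≟ u) refl ∷ dec-true (v ≟ v) refl ∷ [])))
  withEdge-new swapped = Adj-sym withEdge (withEdge-new same)

  withEdge⁻ : ∀ {p q} → Adj withEdge p q → Adj G p q ⊎ SamePair p q u v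
  withEdge⁻ {p} {q} e with ∨-true⁻ (adj G p q) e
  ... | inj₁ p~q = inj₁ p~q
  ... | inj₂ e′ with ∨-true⁻ (does (p ≟ u) ∧ does (q ≟ v)) e′
  ...   | inj₁ e″
          with p≡u ∷ q≡v ∷ [] ← ⋀⁻ (does (p ≟ u) ∷ does (q ≟ v) ∷ []) e″
          with refl ← does-true⇒ (p ≟ u) p≡u | refl ← does-true⇒ (q ≟ v) q≡v
          = inj₂ same
  ...   | inj₂ e″
          with p≡v ∷ q≡u ∷ [] ← ⋀⁻ (does (p ≟ v) ∷ does (q ≟ u) ∷ []) e″
          with refl ← does-true⇒ (p ≟ v) p≡v | refl ← does-true⇒ (q ≟ u) q≡u
          = inj₂ swapped

module UniqueDiamondExtension
  (G : Graph n) {u v : Fin n} (u≢v : u ≢ v) (u≁v : ¬ Adj G u v)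
  (diamond-free : diamondCount (adj G) ≡ 0)
  (one-diamond : diamondCount (addEdge (adj G) u v) ≡ 1)
  where

  G⁺ : Graph n
  G⁺ = withEdge G u≢v

  Common : Fin n → Set
  Common c = Adj G u c × Adj G c v

  Ends : Fin n → Fin n → Set
  Ends p p̄ = SamePair p p̄ u v

  record PathTriangle (p q r : Fin n) : Set where
    constructor pathTriangle
    field
      {opposite} : Fin n
      ends       : Ends p opposite
      common     : Common q
      p~r        : Adj G p r
      q~r        : Adj G q r
  open PathTriangle

  Ends-nonadjacent : ∀ {p p̄} → Ends p p̄ → ¬ Adj G p p̄
  Ends-nonadjacent same    = u≁v
  Ends-nonadjacent swapped = u≁v ∘ Adj-sym G

  Ends-unique : ∀ {p p̄ p̄′} → Ends p p̄ → Ends p p̄′ → p̄ ≡ p̄′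
  Ends-unique same    same    = refl
  Ends-unique swapped swapped = refl
  Ends-unique same    swapped = ⊥-elim (u≢v refl)
  Ends-unique swapped same    = ⊥-elim (u≢v refl)

  Ends-adj⇒Common : ∀ {p p̄ q} → Ends p p̄ → Adj G q p → Adj G q p̄ → Common q
  Ends-adj⇒Common same    q~u q~v = Adj-sym G q~u , q~v
  Ends-adj⇒Common swapped q~v q~u = Adj-sym G q~u , q~v

  Common⇒Ends-adj : ∀ {p p̄ q} → Ends p p̄ → Common q → Adj G p q × Adj G q p̄
  Common⇒Ends-adj same    (u~q , q~v) = u~q , q~v
  Common⇒Ends-adj swapped (u~q , q~v) = Adj-sym G q~v , Adj-sym G u~q

  Common⇒¬Ends : ∀ {p q} → Common q → ¬ Ends p q
  Common⇒¬Ends (u~v , _) same    = u≁v u~v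
  Common⇒¬Ends (u~u , _) swapped = Adj⇒≢ G u~u refl

  Common⇒Diamond : ∀ {c c′} → Common c → Common c′ → c ≢ c′ → Diamond G⁺ u v c c′
  Common⇒Diamond (u~c , c~v) (u~c′ , c′~v) c≢c′ = record
    { z≢w = c≢c′ ; x~y = withEdge-new G u≢v same
    ; x~z = withEdge⁺ G u≢v u~c ; x~w = withEdge⁺ G u≢v u~c′
    ; y~z = withEdge⁺ G u≢v (Adj-sym G c~v) ; y~w = withEdge⁺ G u≢v (Adj-sym G c′~v) }

  PathTriangle⇒Diamond : ∀ {p q r} (t : PathTriangle p q r) → Diamond G⁺ p q (opposite t) r
  PathTriangle⇒Diamond t with p~q , q~p̄ ← Common⇒Ends-adj (ends t) (common t) = record
    { z≢w = λ { refl → Ends-nonadjacent (ends t) (p~r t) }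
    ; x~y = withEdge⁺ G u≢v p~q ; x~z = withEdge-new G u≢v (ends t)
    ; x~w = withEdge⁺ G u≢v (p~r t) ; y~z = withEdge⁺ G u≢v q~p̄ ; y~w = withEdge⁺ G u≢v (q~r t) }

  data Shape : Set where
    uv-chord : ∀ {c c′} → Common c → Common c′ → c ≢ c′ → Shape
    uv-side  : ∀ {p q r} → PathTriangle p q r → Shape

  ¬Diamond : ∀ {x y z w} → ¬ Diamond G x y z w
  ¬Diamond d with () ← subst (0 <_) diamond-free (Diamond⇒0<diamondCount G d)

  off-Ends⇒Adj : ∀ {x z y t} → Ends x z → y ≢ x → y ≢ z → Adj G⁺ y t → Adj G y t
  off-Ends⇒Adj xz y≢x y≢z y~t with withEdge⁻ G u≢v y~t
  ... | inj₁ y~t′ = y~t′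
  ... | inj₂ yt with SamePair-trans yt (SamePair-sym xz)
  ...   | same    = ⊥-elim (y≢x refl)
  ...   | swapped = ⊥-elim (y≢z refl)

  Ends-tip⇒Common : ∀ {x y t} → Ends x y → Adj G⁺ x t → Adj G⁺ y t → Common t
  Ends-tip⇒Common {t = t} xy x~t y~t =
    Ends-adj⇒Common xy (lower (Adj-sym G⁺ x~t)) (lower (Adj-sym G⁺ y~t))
    where
    lower : ∀ {s} → Adj G⁺ t s → Adj G t s
    lower = off-Ends⇒Adj xy (Adj⇒≢ G⁺ (Adj-sym G⁺ x~t)) (Adj⇒≢ G⁺ (Adj-sym G⁺ y~t))

  chord-shape : ∀ {x y z w} → Diamond G⁺ x y z w → Ends x y → Shape
  chord-shape d xy =
    uv-chord (Ends-tip⇒Common xy (x~z d) (y~z d)) (Ends-tip⇒Common xy (x~w d) (y~w d)) (z≢w d)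

  side-shape : ∀ {x y z w} → Diamond G⁺ x y z w → Ends x z → Shape
  side-shape {x} {y} {z} {w} d xz = uv-side (pathTriangle xz
    (Ends-tip⇒Common xz (x~y d) (Adj-sym G⁺ (y~z d)))
    (Adj-sym G (off-Ends⇒Adj xz w≢x (z≢w d ∘ sym) (Adj-sym G⁺ (x~w d))))
    (off-Ends⇒Adj xz y≢x (Adj⇒≢ G⁺ (y~z d)) (y~w d)))
    where
    w≢x : w ≢ x
    w≢x = Adj⇒≢ G⁺ (Adj-sym G⁺ (x~w d))
    y≢x : y ≢ x
    y≢x = Adj⇒≢ G⁺ (Adj-sym G⁺ (x~y d))

  -- The edge uv lies in every diamond of G⁺, since G has none.
  shape : ∀ {x y z w} → Diamond G⁺ x y z w → Shape
  shape d with withEdge⁻ G u≢v (x~y d)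
  ... | inj₂ xy = chord-shape d xy
  ... | inj₁ x~y′ with withEdge⁻ G u≢v (x~z d)
  ... | inj₂ xz = side-shape d xz
  ... | inj₁ x~z′ with withEdge⁻ G u≢v (x~w d)
  ... | inj₂ xw = side-shape (Diamond-swap-tips G⁺ d) xw
  ... | inj₁ x~w′ with withEdge⁻ G u≢v (y~z d)
  ... | inj₂ yz = side-shape (Diamond-swap-chord G⁺ d) yz
  ... | inj₁ y~z′ with withEdge⁻ G u≢v (y~w d)
  ... | inj₂ yw = side-shape (Diamond-swap-chord G⁺ (Diamond-swap-tips G⁺ d)) yw
  ... | inj₁ y~w′ = ⊥-elim (¬Diamond (record
    { z≢w = z≢w d ; x~y = x~y′ ; x~z = x~z′ ; x~w = x~w′ ; y~z = y~z′ ; y~w = y~w′ }))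

  Diamond⁺-unique : ∀ {x y z w x′ y′ z′ w′} → Diamond G⁺ x y z w → Diamond G⁺ x′ y′ z′ w′ →
                    SamePair x y x′ y′ × SamePair z w z′ w′
  Diamond⁺-unique = diamondCount≤1⇒Diamond-unique G⁺ (≤-reflexive one-diamond)

  the-shape : Shape
  the-shape = let _ , _ , _ , _ , d = 0<diamondCount⇒Diamond G⁺ (≤-reflexive (sym one-diamond))
              in shape d

  Shape⇒Common : Shape → ∃[ c ] Common c
  Shape⇒Common (uv-chord h _ _) = _ , h
  Shape⇒Common (uv-side t)      = _ , common t

  Common-coincide : ∀ {c₁ c₂ c₃} → Common c₁ → Common c₂ → Common c₃ →
                    c₁ ≡ c₂ ⊎ c₁ ≡ c₃ ⊎ c₂ ≡ c₃
  Common-coincide {c₁} {c₂} {c₃} h₁ h₂ h₃ with c₁ ≟ c₂ | c₁ ≟ c₃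
  ... | yes c₁≡c₂ | _         = inj₁ c₁≡c₂
  ... | no _      | yes c₁≡c₃ = inj₂ (inj₁ c₁≡c₃)
  ... | no c₁≢c₂  | no c₁≢c₃
    with proj₂ (Diamond⁺-unique (Common⇒Diamond h₁ h₂ c₁≢c₂) (Common⇒Diamond h₁ h₃ c₁≢c₃))
  ...   | same    = inj₂ (inj₂ refl)
  ...   | swapped = ⊥-elim (c₁≢c₃ refl)

  PathTriangle⇒Common-unique : ∀ {p q r c} → PathTriangle p q r → Common c → c ≡ q
  PathTriangle⇒Common-unique {q = q} {c = c} t h with c ≟ q
  ... | yes c≡q = c≡q
  ... | no c≢q  = ⊥-elim (Common⇒¬Ends (common t) (SamePair-sym
    (proj₁ (Diamond⁺-unique (Common⇒Diamond h (common t) c≢q) (PathTriangle⇒Diamond t)))))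

  Common-unique⇒PathTriangle : (∀ {c c′} → Common c → Common c′ → c ≡ c′) → Shape →
                               ∃[ p ] ∃[ q ] ∃[ r ] PathTriangle p q r
  Common-unique⇒PathTriangle unique (uv-chord h h′ c≢c′) = ⊥-elim (c≢c′ (unique h h′))
  Common-unique⇒PathTriangle unique (uv-side t)          = _ , _ , _ , t

  PathTriangle-unique : ∀ {p q r p′ q′ r′} → PathTriangle p q r → PathTriangle p′ q′ r′ →
                        p ≡ p′ × q ≡ q′ × r ≡ r′
  PathTriangle-unique t@(pathTriangle e h p~r _) t′@(pathTriangle e′ h′ _ _)
    with refl ← PathTriangle⇒Common-unique t h′
    with Diamond⁺-unique (PathTriangle⇒Diamond t) (PathTriangle⇒Diamond t′)
  ... | swapped , _ = ⊥-elim (Adj⇒≢ G (proj₁ (Common⇒Ends-adj e h)) refl)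
  ... | same , tips with refl ← Ends-unique e e′ with tips
  ...   | same    = refl , refl , refl
  ...   | swapped = ⊥-elim (Ends-nonadjacent e p~r)

  -- `paths2 G u v` is definitionally `Σ[ n ] (ind ∘ common?)`, and `onPath2 G u v p q`
  -- is `adj G p q ∧ ((end? p ∧ common? q) ∨ (end? q ∧ common? p))`.
  common? : Fin n → Bool
  common? c = adj G u c ∧ adj G c v

  end? : Fin n → Bool
  end? p = does (p ≟ u) ∨ does (p ≟ v)

  common?⁻ : ∀ {c} → common? c ≡ true → Common c
  common?⁻ {c} e with u~c ∷ c~v ∷ [] ← ⋀⁻ (adj G u c ∷ adj G c v ∷ []) e = u~c , c~v

  common?⁺ : ∀ {c} → Common c → common? c ≡ true
  common?⁺ (u~c , c~v) = ⋀⁺ (u~c ∷ c~v ∷ [])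

  end?⁻ : ∀ {p} → end? p ≡ true → ∃[ p̄ ] Ends p p̄
  end?⁻ {p} e with ∨-true⁻ (does (p ≟ u)) e
  ... | inj₁ p≟u with refl ← does-true⇒ (p ≟ u) p≟u = v , same
  ... | inj₂ p≟v with refl ← does-true⇒ (p ≟ v) p≟v = u , swapped

  end?⁺ : ∀ {p p̄} → Ends p p̄ → end? p ≡ true
  end?⁺ same    = ∨-trueˡ _ (dec-true (u ≟ u) refl)
  end?⁺ swapped = ∨-trueʳ (does (v ≟ u)) (dec-true (v ≟ v) refl)

  PathEdge : Fin n → Fin n → Set
  PathEdge p q = (∃[ p̄ ] Ends p p̄) × Common q

  OnPath : Fin n → Fin n → Set
  OnPath p q = PathEdge p q ⊎ PathEdge q p

  onPath2⁻ : ∀ {p q} → onPath2 G u v p q ≡ true → OnPath p q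
  onPath2⁻ {p} {q} e with _ ∷ e′ ∷ [] ← ⋀⁻ (adj G p q ∷ _ ∷ []) e
    with ∨-true⁻ (end? p ∧ common? q) e′
  ... | inj₁ e″ with end ∷ c ∷ [] ← ⋀⁻ (end? p ∷ common? q ∷ []) e″ =
    inj₁ (end?⁻ end , common?⁻ c)
  ... | inj₂ e″ with end ∷ c ∷ [] ← ⋀⁻ (end? q ∷ common? p ∷ []) e″ =
    inj₂ (end?⁻ end , common?⁻ c)

  onPath2⁺ : ∀ {p q} → Adj G p q → OnPath p q → onPath2 G u v p q ≡ true
  onPath2⁺ p~q (inj₁ ((_ , e) , h)) =
    ⋀⁺ (p~q ∷ ∨-trueˡ _ (⋀⁺ (end?⁺ e ∷ common?⁺ h ∷ [])) ∷ [])
  onPath2⁺ {p} {q} p~q (inj₂ ((_ , e) , h)) =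
    ⋀⁺ (p~q ∷ ∨-trueʳ (end? p ∧ common? q) (⋀⁺ (end?⁺ e ∷ common?⁺ h ∷ [])) ∷ [])

  record TriangleOnPath (x y z : Fin n) : Set where
    constructor triangleOnPath
    field
      x~y     : Adj G x y
      y~z     : Adj G y z
      x~z     : Adj G x z
      on-path : OnPath x y ⊎ OnPath y z ⊎ OnPath x z

  TriangleOnPath-swap₁₂ : ∀ {x y z} → TriangleOnPath x y z → TriangleOnPath y x z
  TriangleOnPath-swap₁₂ (triangleOnPath x~y y~z x~z o) =
    triangleOnPath (Adj-sym G x~y) x~z y~z (Sum.map Sum.swap Sum.swap o)

  TriangleOnPath-swap₂₃ : ∀ {x y z} → TriangleOnPath x y z → TriangleOnPath x z y
  TriangleOnPath-swap₂₃ (triangleOnPath x~y y~z x~z o) =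
    triangleOnPath x~z (Adj-sym G y~z) x~y (swap o)
    where
    swap : ∀ {x y z} → OnPath x y ⊎ OnPath y z ⊎ OnPath x z → OnPath x z ⊎ OnPath z y ⊎ OnPath x y
    swap (inj₁ xy)        = inj₂ (inj₂ xy)
    swap (inj₂ (inj₁ yz)) = inj₂ (inj₁ (Sum.swap yz))
    swap (inj₂ (inj₂ xz)) = inj₁ xz

  PathTriangle⇒TriangleOnPath : ∀ {p q r} → PathTriangle p q r → TriangleOnPath p q r
  PathTriangle⇒TriangleOnPath (pathTriangle e h p~r q~r) =
    triangleOnPath (proj₁ (Common⇒Ends-adj e h)) q~r p~r (inj₁ (inj₁ ((_ , e) , h)))

  OnPath⇒PathTriangle : ∀ {p q r} → OnPath p q → Adj G p r → Adj G q r →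
           ∃[ p′ ] ∃[ q′ ] PathTriangle p′ q′ r × (p ∷ q ∷ r ∷ []) ↭ (p′ ∷ q′ ∷ r ∷ [])
  OnPath⇒PathTriangle (inj₁ ((_ , e) , h)) p~r q~r = _ , _ , pathTriangle e h p~r q~r , ↭-refl
  OnPath⇒PathTriangle (inj₂ ((_ , e) , h)) p~r q~r =
    _ , _ , pathTriangle e h q~r p~r , ↭-swap _ _ ↭-refl

  TriangleOnPath⇒PathTriangle : ∀ {x y z} → TriangleOnPath x y z →
    ∃[ p ] ∃[ q ] ∃[ r ] PathTriangle p q r × (x ∷ y ∷ z ∷ []) ↭ (p ∷ q ∷ r ∷ [])
  TriangleOnPath⇒PathTriangle (triangleOnPath x~y y~z x~z (inj₁ xy))
    with p , q , t , π ← OnPath⇒PathTriangle xy x~z y~z = p , q , _ , t , π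
  TriangleOnPath⇒PathTriangle {x} {y} {z} (triangleOnPath x~y y~z x~z (inj₂ (inj₁ yz)))
    with p , q , t , π ← OnPath⇒PathTriangle yz (Adj-sym G x~y) (Adj-sym G x~z) =
    p , q , x , t , ↭-trans (↭-trans (↭-swap x y ↭-refl) (↭-prep y (↭-swap x z ↭-refl))) π
  TriangleOnPath⇒PathTriangle {x} {y} {z} (triangleOnPath x~y y~z x~z (inj₂ (inj₂ xz)))
    with p , q , t , π ← OnPath⇒PathTriangle xz x~y (Adj-sym G y~z) =
    p , q , y , t , ↭-trans (↭-prep x (↭-swap y z ↭-refl)) π

  onPath2-any⁻ : ∀ {x y z} → (onPath2 G u v x y ∨ onPath2 G u v y z ∨ onPath2 G u v x z) ≡ true →
                 OnPath x y ⊎ OnPath y z ⊎ OnPath x z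
  onPath2-any⁻ {x} {y} {z} e with ∨-true⁻ (onPath2 G u v x y) e
  ... | inj₁ xy = inj₁ (onPath2⁻ xy)
  ... | inj₂ e′ = inj₂ (Sum.map onPath2⁻ onPath2⁻ (∨-true⁻ (onPath2 G u v y z) e′))

  onPath2-any⁺ : ∀ {x y z} → TriangleOnPath x y z →
                 (onPath2 G u v x y ∨ onPath2 G u v y z ∨ onPath2 G u v x z) ≡ true
  onPath2-any⁺ (triangleOnPath x~y _ _ (inj₁ xy)) = ∨-trueˡ _ (onPath2⁺ x~y xy)
  onPath2-any⁺ {x} {y} (triangleOnPath _ y~z _ (inj₂ (inj₁ yz))) =
    ∨-trueʳ (onPath2 G u v x y) (∨-trueˡ _ (onPath2⁺ y~z yz))
  onPath2-any⁺ {x} {y} {z} (triangleOnPath _ _ x~z (inj₂ (inj₂ xz))) =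
    ∨-trueʳ (onPath2 G u v x y) (∨-trueʳ (onPath2 G u v y z) (onPath2⁺ x~z xz))

  triangleConjuncts : Fin n → Fin n → Fin n → List Bool
  triangleConjuncts x y z =
    lt x y ∷ lt y z ∷ adj G x y ∷ adj G y z ∷ adj G x z ∷
    (onPath2 G u v x y ∨ onPath2 G u v y z ∨ onPath2 G u v x z) ∷ []

  -- `trianglesOnPaths2 G u v` is definitionally `Σ³ triangleIndicator`.
  triangleIndicator : Fin n → Fin n → Fin n → ℕ
  triangleIndicator x y z = ind (⋀ (triangleConjuncts x y z))

  sorted-TriangleOnPath⇒indicator : ∀ {x y z} → x <ᶠ y → y <ᶠ z → TriangleOnPath x y z →
                                    0 < triangleIndicator x y z
  sorted-TriangleOnPath⇒indicator {x} {y} {z} x<y y<z t@(triangleOnPath x~y y~z x~z _) =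
    true⇒0<ind (⋀⁺ (dec-true (x <? y) x<y ∷ dec-true (y <? z) y<z ∷
                    x~y ∷ y~z ∷ x~z ∷ onPath2-any⁺ t ∷ []))

  indicator⇒sorted-TriangleOnPath : ∀ {x y z} → 0 < triangleIndicator x y z →
                                    x <ᶠ y × y <ᶠ z × TriangleOnPath x y z
  indicator⇒sorted-TriangleOnPath {x} {y} {z} h
    with x<y ∷ y<z ∷ x~y ∷ y~z ∷ x~z ∷ o ∷ [] ← ⋀⁻ (triangleConjuncts x y z) (0<ind⇒true h)
    = does-true⇒ (x <? y) x<y , does-true⇒ (y <? z) y<z ,
      triangleOnPath x~y y~z x~z (onPath2-any⁻ o)

  triangleIndicator-unique : ∀ {x y z x′ y′ z′} →
    0 < triangleIndicator x y z → 0 < triangleIndicator x′ y′ z′ → x ≡ x′ × y ≡ y′ × z ≡ z′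
  triangleIndicator-unique h h′
    with x<y , y<z , t ← indicator⇒sorted-TriangleOnPath h
       | x′<y′ , y′<z′ , t′ ← indicator⇒sorted-TriangleOnPath h′
    with _ , _ , _ , pt , π ← TriangleOnPath⇒PathTriangle t
       | _ , _ , _ , pt′ , π′ ← TriangleOnPath⇒PathTriangle t′
    with refl , refl , refl ← PathTriangle-unique pt pt′
    = sorted₃-↭-unique x<y y<z x′<y′ y′<z′ (↭-trans π (↭-sym π′))

  triangles≤1 : trianglesOnPaths2 G u v ≤ 1
  triangles≤1 = Σ³≤1 triangleIndicator (λ x y z → ind≤1 (⋀ (triangleConjuncts x y z)))
                     triangleIndicator-unique

  PathTriangle⇒0<triangles : ∀ {p q r} → PathTriangle p q r → 0 < trianglesOnPaths2 G u v
  PathTriangle⇒0<triangles t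
    with x , y , z , x<y , y<z , t′ ← sort₃ TriangleOnPath (Adj⇒≢ G ∘ TriangleOnPath.x~y)
           TriangleOnPath-swap₁₂ TriangleOnPath-swap₂₃ (PathTriangle⇒TriangleOnPath t)
    = ≤-trans (sorted-TriangleOnPath⇒indicator x<y y<z t′) (≤-Σ³ triangleIndicator x y z)

  0<triangles⇒PathTriangle : 0 < trianglesOnPaths2 G u v → ∃[ p ] ∃[ q ] ∃[ r ] PathTriangle p q r
  0<triangles⇒PathTriangle 0<T
    with x , y , z , h ← Σ³-pos⇒∃ triangleIndicator 0<T
    with _ , _ , t ← indicator⇒sorted-TriangleOnPath {x} {y} {z} h
    with p , q , r , pt , _ ← TriangleOnPath⇒PathTriangle t
    = p , q , r , pt

  Common⇒0<ind : ∀ {c} → Common c → 0 < ind (common? c)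
  Common⇒0<ind = true⇒0<ind ∘ common?⁺

  0<ind⇒Common : ∀ {c} → 0 < ind (common? c) → Common c
  0<ind⇒Common = common?⁻ ∘ 0<ind⇒true

  1≤paths2 : 1 ≤ paths2 G u v
  1≤paths2 = let c , h = Shape⇒Common the-shape in
             ≤-trans (Common⇒0<ind h) (≤-Σ (ind ∘ common?) c)

  paths2≤2 : paths2 G u v ≤ 2
  paths2≤2 = Σ≤2 (ind ∘ common?) (ind≤1 ∘ common?) λ p q r →
    Common-coincide (0<ind⇒Common p) (0<ind⇒Common q) (0<ind⇒Common r)

  paths2≤1⇒Common-unique : paths2 G u v ≤ 1 → ∀ {c c′} → Common c → Common c′ → c ≡ c′
  paths2≤1⇒Common-unique P≤1 h h′ =
    Σ≤1⇒unique (ind ∘ common?) P≤1 (Common⇒0<ind h) (Common⇒0<ind h′)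

  Common-unique⇒paths2≤1 : (∀ {c c′} → Common c → Common c′ → c ≡ c′) → paths2 G u v ≤ 1
  Common-unique⇒paths2≤1 unique = Σ≤1 (ind ∘ common?) (ind≤1 ∘ common?) λ p q →
    unique (0<ind⇒Common p) (0<ind⇒Common q)

  distance₂ : Distance G u v 2
  distance₂ = let _ , u~c , c~v = Shape⇒Common the-shape in
              common-neighbour⇒distance₂ G u≢v u≁v u~c c~v

  paths2≡1⊎2 : paths2 G u v ≡ 1 ⊎ paths2 G u v ≡ 2
  paths2≡1⊎2 = 1≤m≤2⇒m≡1⊎m≡2 1≤paths2 paths2≤2

  paths2≡1⇔triangles≡1 : paths2 G u v ≡ 1 ⇔ trianglesOnPaths2 G u v ≡ 1
  paths2≡1⇔triangles≡1 = mk⇔ to from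
    where
    to : paths2 G u v ≡ 1 → trianglesOnPaths2 G u v ≡ 1
    to P≡1 =
      let _ , _ , _ , t = Common-unique⇒PathTriangle
                            (paths2≤1⇒Common-unique (≤-reflexive P≡1)) the-shape
      in ≤-antisym triangles≤1 (PathTriangle⇒0<triangles t)
    from : trianglesOnPaths2 G u v ≡ 1 → paths2 G u v ≡ 1
    from T≡1 =
      let _ , _ , _ , t = 0<triangles⇒PathTriangle (≤-reflexive (sym T≡1))
      in ≤-antisym (Common-unique⇒paths2≤1 λ h h′ →
          trans (PathTriangle⇒Common-unique t h) (sym (PathTriangle⇒Common-unique t h′)))
        1≤paths2

lemma2p2 : ∀ {n} (G : Graph n) → Nontrivial G → UniquelyDiamondSaturated G →
    ∀ (u v : Fin n) → ¬ u ≡ v → ¬ Adj G u v →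
    Distance G u v 2 ×
    (paths2 G u v ≡ 1 ⊎ paths2 G u v ≡ 2) ×
    (paths2 G u v ≡ 1 ⇔ trianglesOnPaths2 G u v ≡ 1)
lemma2p2 G _ (diamond-free , saturated) u v u≢v u≁v =
  distance₂ , paths2≡1⊎2 , paths2≡1⇔triangles≡1
  where
  open UniqueDiamondExtension G u≢v u≁v diamond-free (saturated u v u≢v u≁v)
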